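{- For every integer $k\ge 0$, $M_{k,\mathrm{T}\cdots\mathrm{T}}\le\mathrm{Fib}_{k+2}$.
   Context: Unordered CNF game: an instance is a pair $(\varphi,X)$ where $\varphi$ is a CNF formula (a set of clauses, each clause a disjunction of literals $x_i$ or $\overline{x}_i$) and $X$ is a finite set of boolean variables containing every variable appearing in $\varphi$. Two players, T and F, alternate turns; on each turn the player picks a not-yet-assigned variable from $X$ and assigns it $0$ or $1$. The game ends when all variables are assigned; T wins if $\varphi$ is satisfied and F wins otherwise. A CNF is $k$-uniform if every clause has exactly $k$ literals, on $k$ distinct variables. $M_{k,\mathrm{T}\cdots\mathrm{T}}$ denotes the minimum number of clauses of $\varphi$ over all instances $(\varphi,X)$ with $\varphi$ $k$-uniform and $|X|$ odd such that F has a winning strategy when T moves first (so T also moves last). $\mathrm{Fib}_n$ is the $n$-th Fibonacci number, with $\mathrm{Fib}_1=\mathrm{Fib}_2=1$ and $\mathrm{Fib}_{n}=\mathrm{Fib}_{n-1}+\mathrm{Fib}_{n-2}$. -}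

module Defs where

open import Data.Nat using (ℕ; zero; suc; _+_; _*_)
open import Data.Fin using (Fin; _≟_)
open import Data.Bool using (Bool)
open import Data.Maybe using (Maybe; just; nothing)
open import Data.Product using (Σ; ∃; _×_; _,_; proj₁)
open import Data.List using (List; length; map)
open import Data.List.Relation.Unary.All using (All)
open import Data.List.Relation.Unary.Any using (Any)
open import Data.List.Relation.Unary.Unique.Propositional using (Unique)
open import Relation.Binary.PropositionalEquality using (_≡_)
open import Relation.Nullary using (¬_; yes; no)

fib : ℕ → ℕ
fib zero = zero
fib (suc zero) = suc zero
fib (suc (suc n)) = fib (suc n) + fib n

Odd : ℕ → Set
Odd n = ∃ λ m → n ≡ suc (2 * m)

-- The variable set X is Fin n (so |X| = n).
-- A literal is a variable together with a polarity:
-- (i , true) is x_i, (i , false) is the negation of x_i.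
Literal : ℕ → Set
Literal n = Fin n × Bool

Clause : ℕ → Set
Clause n = List (Literal n)

CNF : ℕ → Set
CNF n = List (Clause n)

KClause : ∀ {n} → ℕ → Clause n → Set
KClause k c = length c ≡ k × Unique (map proj₁ c)

Uniform : ∀ {n} → ℕ → CNF n → Set
Uniform k φ = All (KClause k) φ

PAssign : ℕ → Set
PAssign n = Fin n → Maybe Bool

empty : ∀ {n} → PAssign n
empty _ = nothing

assign : ∀ {n} → PAssign n → Fin n → Bool → PAssign n
assign ρ i b j with j ≟ i
... | yes _ = just b
... | no _ = ρ j

LitTrue : ∀ {n} → PAssign n → Literal n → Set
LitTrue ρ (i , b) = ρ i ≡ just b

Satisfies : ∀ {n} → PAssign n → CNF n → Set
Satisfies ρ φ = All (λ c → Any (LitTrue ρ) c) φ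

-- F has a winning strategy from position ρ with m moves remaining.
-- FWinT: T is to move; FWinF: F is to move.
mutual
  FWinT : ∀ {n} → CNF n → ℕ → PAssign n → Set
  FWinT φ zero ρ = ¬ Satisfies ρ φ
  FWinT φ (suc m) ρ = ∀ i b → ρ i ≡ nothing → FWinF φ m (assign ρ i b)

  FWinF : ∀ {n} → CNF n → ℕ → PAssign n → Set
  FWinF φ zero ρ = ¬ Satisfies ρ φ
  FWinF φ (suc m) ρ = Σ (Fin _) λ i → Σ Bool λ b → ρ i ≡ nothing × FWinT φ m (assign ρ i b)

FWinsTFirst : ∀ {n} → CNF n → Set
FWinsTFirst {n} φ = FWinT φ n empty

-- φ_r is the CNF on 2r + 1 variables given by φ₀ = {□}, φ₁ = {x₀ , ¬x₀} and
--   φ_{r+2} = { x₀ ∨ C | C ∈ φ_{r+1} } ∪ { ¬x₀ ∨ z₀ ∨ C | C ∈ φ_r },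
-- where the copy of φ_{r+1} lives on the variables after the pair (x₀ , z₀) and the copy of φ_r
-- after the first two pairs; so φ_r is r-uniform with Fib_{r+2} clauses.  F splits the variables
-- into pairs (x₀ , z₀) , (x₁ , z₁) , … and one spare variable, and answers each move of T in an
-- untouched pair inside that pair so that x = 0, or x = 1 and z = 0; on any other turn F sets a
-- free variable without breaking this.  In the final assignment every pair is settled, and a
-- settled first pair reduces φ_{r+2} to its copy of φ_{r+1} (x₀ = 0) or of φ_r (x₀ = 1, z₀ = 0).

module Submission where

open import Defs
open import Data.Nat using (ℕ; zero; suc; pred; _≤_; _+_; _*_)
open import Data.Nat.Properties using (+-suc; *-suc; +-comm; ≤-reflexive; 0≢1+n)
open import Data.Fin using (Fin; zero; suc; _≟_)
open import Data.Fin.Properties using (suc-injective)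
open import Data.Bool using (Bool; true; false; not)
open import Data.Maybe using (Maybe; just; nothing; maybe′)
open import Data.Product using (Σ; ∃; _×_; _,_; proj₁; map₁)
open import Data.Sum using (_⊎_; inj₁; inj₂)
open import Data.Unit using (⊤; tt)
open import Data.Empty using (⊥-elim)
open import Data.List using ([]; _∷_; map; _++_; length)
open import Data.List.Properties using (length-++; length-map; map-∘)
open import Data.List.Relation.Unary.All as All using (All; []; _∷_)
import Data.List.Relation.Unary.All.Properties as Allₚ
open import Data.List.Relation.Unary.Any as Any using (here)
import Data.List.Relation.Unary.Any.Properties as Anyₚ
open import Data.List.Relation.Unary.AllPairs using ([]; _∷_)
open import Data.List.Relation.Unary.Unique.Propositional using (Unique)
import Data.List.Relation.Unary.Unique.Propositional.Properties as Uniqueₚ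
open import Function using (_∘_)
open import Function.Definitions using (Injective)
open import Relation.Binary.PropositionalEquality
  using (_≡_; _≢_; _≗_; refl; sym; trans; cong; cong₂; subst; subst₂; module ≡-Reasoning)
open import Relation.Nullary using (¬_; yes; no)

private
  variable
    m n k : ℕ

nvars : ℕ → ℕ
nvars zero = 1
nvars (suc r) = 2 + nvars r

nvars-odd : ∀ r → nvars r ≡ suc (2 * r)
nvars-odd zero = refl
nvars-odd (suc r) = trans (cong (2 +_) (nvars-odd r)) (cong suc (sym (*-suc 2 r)))

shift₂ : Fin n → Fin (2 + n)
shift₂ i = suc (suc i)

shift₂-injective : Injective _≡_ _≡_ (shift₂ {n})
shift₂-injective = suc-injective ∘ suc-injective

renameClause : (Fin m → Fin n) → Clause m → Clause n
renameClause f = map (map₁ f)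

rename : (Fin m → Fin n) → CNF m → CNF n
rename f = map (renameClause f)

fibCNF : (r : ℕ) → CNF (nvars r)
fibCNF zero = [] ∷ []
fibCNF (suc zero) = ((zero , true) ∷ []) ∷ ((zero , false) ∷ []) ∷ []
fibCNF (suc (suc r)) =
  map ((zero , true) ∷_) (rename shift₂ (fibCNF (suc r))) ++
  map ((zero , false) ∷_) (map ((suc zero , true) ∷_) (rename (shift₂ ∘ shift₂) (fibCNF r)))

length-fibCNF-step : ∀ r → length (fibCNF (suc (suc r))) ≡ length (fibCNF (suc r)) + length (fibCNF r)
length-fibCNF-step r = begin
  length (left ++ right)     ≡⟨ length-++ left ⟩
  length left + length right ≡⟨ cong₂ _+_ length-left length-right ⟩
  length (fibCNF (suc r)) + length (fibCNF r) ∎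
  where
  open ≡-Reasoning
  left right : CNF (nvars (suc (suc r)))
  left = map ((zero , true) ∷_) (rename shift₂ (fibCNF (suc r)))
  right = map ((zero , false) ∷_) (map ((suc zero , true) ∷_) (rename (shift₂ ∘ shift₂) (fibCNF r)))
  length-left : length left ≡ length (fibCNF (suc r))
  length-left = trans (length-map _ (rename shift₂ (fibCNF (suc r)))) (length-map _ (fibCNF (suc r)))
  length-right : length right ≡ length (fibCNF r)
  length-right = trans (length-map _ (map _ (rename (shift₂ ∘ shift₂) (fibCNF r))))
                   (trans (length-map _ (rename (shift₂ ∘ shift₂) (fibCNF r))) (length-map _ (fibCNF r)))

length-fibCNF : ∀ r → length (fibCNF r) ≡ fib (2 + r)
length-fibCNF zero = refl
length-fibCNF (suc zero) = refl
length-fibCNF (suc (suc r)) =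
  trans (length-fibCNF-step r) (cong₂ _+_ (length-fibCNF (suc r)) (length-fibCNF r))

Fresh : Fin n → Clause n → Set
Fresh i c = All (i ≢_) (map proj₁ c)

variables-renameClause : (f : Fin m → Fin n) (c : Clause m) → map proj₁ (renameClause f c) ≡ map f (map proj₁ c)
variables-renameClause f c = trans (sym (map-∘ c)) (map-∘ c)

rename-uniform : {f : Fin m → Fin n} → Injective _≡_ _≡_ f → (ψ : CNF m) → Uniform k ψ → Uniform k (rename f ψ)
rename-uniform {f = f} f-injective ψ = Allₚ.map⁺ ∘ All.map renamed
  where
  renamed : ∀ {c} → KClause k c → KClause k (renameClause f c)
  renamed {c = c} (size , distinct) =
    trans (length-map _ c) size ,
    subst Unique (sym (variables-renameClause f c)) (Uniqueₚ.map⁺ f-injective distinct)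

rename-fresh : {i : Fin n} {f : Fin m → Fin n} → (∀ j → i ≢ f j) → (ψ : CNF m) → All (Fresh i) (rename f ψ)
rename-fresh outside = Allₚ.map⁺ ∘ All.universal (λ c → Allₚ.map⁺ (Allₚ.map⁺ (All.universal (outside ∘ proj₁) c)))

prepend-fresh : {i : Fin n} {l : Literal n} {ψ : CNF n} → i ≢ proj₁ l → All (Fresh i) ψ → All (Fresh i) (map (l ∷_) ψ)
prepend-fresh i≢l = Allₚ.map⁺ ∘ All.map (i≢l ∷_)

prepend-uniform : {l : Literal n} {ψ : CNF n} → All (Fresh (proj₁ l)) ψ → Uniform k ψ → Uniform (suc k) (map (l ∷_) ψ)
prepend-uniform [] [] = []
prepend-uniform (fresh ∷ fs) ((size , distinct) ∷ us) = (cong suc size , fresh ∷ distinct) ∷ prepend-uniform fs us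

fibCNF-uniform : ∀ r → Uniform r (fibCNF r)
fibCNF-uniform zero = (refl , []) ∷ []
fibCNF-uniform (suc zero) = (refl , [] ∷ []) ∷ (refl , [] ∷ []) ∷ []
fibCNF-uniform (suc (suc r)) = Allₚ.++⁺
  (prepend-uniform (rename-fresh (λ _ ()) _) (rename-uniform shift₂-injective _ (fibCNF-uniform (suc r))))
  (prepend-uniform (prepend-fresh (λ ()) (rename-fresh (λ _ ()) _))
    (prepend-uniform (rename-fresh (λ _ ()) _)
      (rename-uniform (shift₂-injective ∘ shift₂-injective) _ (fibCNF-uniform r))))

Satisfies-rename⁻ : {ρ : PAssign n} {f : Fin m → Fin n} (ψ : CNF m) → Satisfies ρ (rename f ψ) → Satisfies (ρ ∘ f) ψ
Satisfies-rename⁻ ψ = All.map Anyₚ.map⁻ ∘ Allₚ.map⁻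

Satisfies-prepend⁻ : {ρ : PAssign n} {l : Literal n} (ψ : CNF n) → ¬ LitTrue ρ l → Satisfies ρ (map (l ∷_) ψ) → Satisfies ρ ψ
Satisfies-prepend⁻ ψ l-false = All.map (Any.tail l-false) ∘ Allₚ.map⁻

conflicting : ∀ {b} {a : Maybe Bool} → a ≡ just b → a ≢ just (not b)
conflicting {false} refl ()
conflicting {true} refl ()

assigned : ∀ {b} {a : Maybe Bool} → a ≡ just b → a ≢ nothing
assigned refl ()

Settled : Maybe Bool → Maybe Bool → Set
Settled x z = x ≡ just false ⊎ (x ≡ just true × z ≡ just false)

Safe : Maybe Bool → Maybe Bool → Set
Safe x z = (x ≡ nothing × z ≡ nothing) ⊎ Settled x z

Pairwise : (Maybe Bool → Maybe Bool → Set) → (r : ℕ) → PAssign (nvars r) → Set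
Pairwise P zero ρ = ⊤
Pairwise P (suc r) ρ = P (ρ zero) (ρ (suc zero)) × Pairwise P r (ρ ∘ shift₂)

Pairwise-cong : ∀ {P} r {ρ σ : PAssign (nvars r)} → ρ ≗ σ → Pairwise P r ρ → Pairwise P r σ
Pairwise-cong zero _ _ = tt
Pairwise-cong {P} (suc r) ρ≗σ (p , rest) = subst₂ P (ρ≗σ zero) (ρ≗σ (suc zero)) p , Pairwise-cong r (ρ≗σ ∘ shift₂) rest

fibCNF-falsified : ∀ r {ρ : PAssign (nvars r)} → Pairwise Settled r ρ → ¬ Satisfies ρ (fibCNF r)
fibCNF-falsified zero _ (() ∷ [])
fibCNF-falsified (suc zero) _ (here x≡1 ∷ here x≡0 ∷ []) = conflicting x≡1 x≡0
fibCNF-falsified (suc (suc r)) (inj₁ x≡0 , settled) sat =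
  fibCNF-falsified (suc r) settled
    (Satisfies-rename⁻ (fibCNF (suc r)) (Satisfies-prepend⁻ _ (conflicting x≡0) (Allₚ.++⁻ˡ _ sat)))
fibCNF-falsified (suc (suc r)) (inj₂ (x≡1 , z≡0) , _ , settled) sat =
  fibCNF-falsified r settled
    (Satisfies-rename⁻ (fibCNF r)
      (Satisfies-prepend⁻ _ (conflicting z≡0) (Satisfies-prepend⁻ _ (conflicting x≡1) (Allₚ.++⁻ʳ _ sat))))

Total : PAssign n → Set
Total ρ = ∀ j → ρ j ≢ nothing

Reply : (PAssign n → Set) → PAssign n → Set
Reply I ρ = Σ (Fin _) λ j → Σ Bool λ c → ρ j ≡ nothing × I (assign ρ j c)

assign-cong : {ρ σ : PAssign n} → ρ ≗ σ → ∀ i b → assign ρ i b ≗ assign σ i b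
assign-cong ρ≗σ i b j with j ≟ i
... | yes _ = refl
... | no _ = ρ≗σ j

assign-suc : (ρ : PAssign (suc n)) → ∀ i b → assign ρ (suc i) b ∘ suc ≗ assign (ρ ∘ suc) i b
assign-suc ρ i b j with j ≟ i
... | yes refl = refl
... | no _ = refl

assign-shift₂ : (ρ : PAssign (2 + n)) → ∀ i b → assign ρ (shift₂ i) b ∘ shift₂ ≗ assign (ρ ∘ shift₂) i b
assign-shift₂ ρ i b j = trans (assign-suc ρ (suc i) b (suc j)) (assign-suc (ρ ∘ suc) i b j)

unassigned : PAssign n → ℕ
unassigned {zero} ρ = 0
unassigned {suc n} ρ = maybe′ (λ _ → 0) 1 (ρ zero) + unassigned (ρ ∘ suc)

unassigned-cong : {ρ σ : PAssign n} → ρ ≗ σ → unassigned ρ ≡ unassigned σ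
unassigned-cong {zero} _ = refl
unassigned-cong {suc n} ρ≗σ = cong₂ _+_ (cong (maybe′ (λ _ → 0) 1) (ρ≗σ zero)) (unassigned-cong (ρ≗σ ∘ suc))

unassigned-empty : ∀ n → unassigned (empty {n}) ≡ n
unassigned-empty zero = refl
unassigned-empty (suc n) = cong suc (unassigned-empty n)

unassigned-assign : (ρ : PAssign n) → ∀ i b → ρ i ≡ nothing → unassigned ρ ≡ suc (unassigned (assign ρ i b))
unassigned-assign {suc n} ρ zero b free rewrite free = refl
unassigned-assign {suc n} ρ (suc i) b free = begin
  v + unassigned (ρ ∘ suc)                       ≡⟨ cong (v +_) (unassigned-assign (ρ ∘ suc) i b free) ⟩
  v + suc (unassigned (assign (ρ ∘ suc) i b))    ≡⟨ +-suc v _ ⟩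
  suc (v + unassigned (assign (ρ ∘ suc) i b))    ≡⟨ cong (λ x → suc (v + x)) (unassigned-cong (sym ∘ assign-suc ρ i b)) ⟩
  suc (v + unassigned (assign ρ (suc i) b ∘ suc)) ∎
  where
  open ≡-Reasoning
  v = maybe′ (λ _ → 0) 1 (ρ zero)

unassigned-assign′ : (ρ : PAssign n) → ∀ i b → ρ i ≡ nothing → unassigned ρ ≡ suc m → unassigned (assign ρ i b) ≡ m
unassigned-assign′ ρ i b free count = cong pred (trans (sym (unassigned-assign ρ i b free)) count)

unassigned≡0⇒Total : (ρ : PAssign n) → unassigned ρ ≡ 0 → Total ρ
unassigned≡0⇒Total ρ none j free = 0≢1+n (trans (sym none) (unassigned-assign ρ j false free))

unassigned≡1+n⇒free : (ρ : PAssign n) → unassigned ρ ≡ suc m → ∃ λ j → ρ j ≡ nothing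
unassigned≡1+n⇒free {suc n} ρ count with ρ zero in eq
... | nothing = zero , eq
... | just _ with unassigned≡1+n⇒free (ρ ∘ suc) count
...   | j , free = suc j , free

record FInvariant (φ : CNF n) (I : PAssign n → Set) : Set where
  field
    respond : ∀ {ρ} i b → I ρ → ρ i ≡ nothing → I (assign ρ i b) ⊎ Reply I (assign ρ i b)
    pass : ∀ {ρ} j → I ρ → ρ j ≡ nothing → Reply I ρ
    falsify : ∀ {ρ} → I ρ → Total ρ → ¬ Satisfies ρ φ

module _ {φ : CNF n} {I : PAssign n → Set} (invariant : FInvariant φ I) where
  open FInvariant invariant

  -- Reply (FWinT φ m) ρ unfolds to FWinF φ (suc m) ρ.
  mutual
    FInvariant⇒FWinT : ∀ m {ρ} → I ρ → unassigned ρ ≡ m → FWinT φ m ρ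
    FInvariant⇒FWinT zero inv none = falsify inv (unassigned≡0⇒Total _ none)
    FInvariant⇒FWinT (suc m) {ρ} inv count i b free =
      FInvariant⇒FWinF m (respond i b inv free) (unassigned-assign′ ρ i b free count)

    FInvariant⇒FWinF : ∀ m {ρ} → I ρ ⊎ Reply I ρ → unassigned ρ ≡ m → FWinF φ m ρ
    FInvariant⇒FWinF zero (inj₁ inv) none = falsify inv (unassigned≡0⇒Total _ none)
    FInvariant⇒FWinF zero (inj₂ (j , _ , free , _)) none = ⊥-elim (unassigned≡0⇒Total _ none j free)
    FInvariant⇒FWinF (suc m) {ρ} (inj₁ inv) count with unassigned≡1+n⇒free ρ count
    ... | j , free = Reply⇒FWinF m (pass j inv free) count
    FInvariant⇒FWinF (suc m) (inj₂ reply) count = Reply⇒FWinF m reply count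

    Reply⇒FWinF : ∀ m {ρ} → Reply I ρ → unassigned ρ ≡ suc m → FWinF φ (suc m) ρ
    Reply⇒FWinF m {ρ} (j , c , free , inv) count =
      j , c , free , FInvariant⇒FWinT m inv (unassigned-assign′ ρ j c free count)

Settled⇒assigned : ∀ {x z} → Settled x z → x ≢ nothing
Settled⇒assigned (inj₁ x≡0) = assigned x≡0
Settled⇒assigned (inj₂ (x≡1 , _)) = assigned x≡1

settle : ∀ b → Settled (just b) (just false)
settle false = inj₁ refl
settle true = inj₂ (refl , refl)

Pairwise-Safe-empty : ∀ r → Pairwise Safe r empty
Pairwise-Safe-empty zero = tt
Pairwise-Safe-empty (suc r) = inj₁ (refl , refl) , Pairwise-Safe-empty r

Pairwise-Safe⇒Settled : ∀ r {ρ : PAssign (nvars r)} → Pairwise Safe r ρ → Total ρ → Pairwise Settled r ρ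
Pairwise-Safe⇒Settled zero _ _ = tt
Pairwise-Safe⇒Settled (suc r) (inj₁ (x-free , _) , _) total = ⊥-elim (total zero x-free)
Pairwise-Safe⇒Settled (suc r) (inj₂ settled , rest) total = settled , Pairwise-Safe⇒Settled r rest (total ∘ shift₂)

Safe-respond : ∀ r {ρ : PAssign (nvars r)} i b → Pairwise Safe r ρ → ρ i ≡ nothing →
               Pairwise Safe r (assign ρ i b) ⊎ Reply (Pairwise Safe r) (assign ρ i b)
Safe-respond zero _ _ _ _ = inj₁ tt
Safe-respond (suc r) zero b (inj₁ (_ , z-free) , rest) _ = inj₂ (suc zero , false , z-free , inj₂ (settle b) , rest)
Safe-respond (suc r) zero _ (inj₂ settled , _) x-free = ⊥-elim (Settled⇒assigned settled x-free)
Safe-respond (suc r) (suc zero) _ (inj₁ (x-free , _) , rest) _ = inj₂ (zero , false , x-free , inj₂ (inj₁ refl) , rest)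
Safe-respond (suc r) (suc zero) _ (inj₂ (inj₁ x≡0) , rest) _ = inj₁ (inj₂ (inj₁ x≡0) , rest)
Safe-respond (suc r) (suc zero) _ (inj₂ (inj₂ (_ , z≡0)) , _) z-free = ⊥-elim (assigned z≡0 z-free)
Safe-respond (suc r) {ρ} (suc (suc i)) b (safe , rest) free with Safe-respond r i b rest free
... | inj₁ rest′ = inj₁ (safe , Pairwise-cong r (sym ∘ assign-shift₂ ρ i b) rest′)
... | inj₂ (j , c , free′ , rest′) =
  inj₂ (shift₂ j , c , trans (assign-shift₂ ρ i b j) free′ , safe , Pairwise-cong r shifted rest′)
  where
  shifted : assign (assign (ρ ∘ shift₂) i b) j c ≗ assign (assign ρ (shift₂ i) b) (shift₂ j) c ∘ shift₂
  shifted k = sym (trans (assign-shift₂ _ j c k) (assign-cong (assign-shift₂ ρ i b) j c k))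

Safe-pass : ∀ r {ρ : PAssign (nvars r)} j → Pairwise Safe r ρ → ρ j ≡ nothing → Reply (Pairwise Safe r) ρ
Safe-pass zero j _ free = j , false , free , tt
Safe-pass (suc r) _ (inj₁ (x-free , _) , rest) _ = zero , false , x-free , inj₂ (inj₁ refl) , rest
Safe-pass (suc r) zero (inj₂ settled , _) x-free = ⊥-elim (Settled⇒assigned settled x-free)
Safe-pass (suc r) (suc zero) (inj₂ (inj₁ x≡0) , rest) z-free = suc zero , false , z-free , inj₂ (inj₁ x≡0) , rest
Safe-pass (suc r) (suc zero) (inj₂ (inj₂ (_ , z≡0)) , _) z-free = ⊥-elim (assigned z≡0 z-free)
Safe-pass (suc r) {ρ} (suc (suc j)) (safe , rest) free with Safe-pass r j rest free
... | j′ , c , free′ , rest′ = shift₂ j′ , c , free′ , safe , Pairwise-cong r (sym ∘ assign-shift₂ ρ j′ c) rest′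

Pairwise-Safe-FInvariant : ∀ r → FInvariant (fibCNF r) (Pairwise Safe r)
Pairwise-Safe-FInvariant r = record
  { respond = Safe-respond r
  ; pass = Safe-pass r
  ; falsify = λ safe total → fibCNF-falsified r (Pairwise-Safe⇒Settled r safe total)
  }

lemma7 : (k : ℕ) → Σ ℕ λ n → Odd n × Σ (CNF n) λ φ → Uniform k φ × FWinsTFirst φ × length φ ≤ fib (k + 2)
lemma7 k =
  nvars k , (k , nvars-odd k) , fibCNF k , fibCNF-uniform k ,
  FInvariant⇒FWinT (Pairwise-Safe-FInvariant k) (nvars k) (Pairwise-Safe-empty k) (unassigned-empty (nvars k)) ,
  ≤-reflexive (trans (length-fibCNF k) (cong fib (+-comm 2 k)))
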